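{- Let $G$ be a connected graph of order $n\geqslant 7$ such that $G^2$ is not a complete graph. If $|E(G)|\geqslant \frac{1}{2}(n^2+10-5n)$, then $D'(G^2)\leqslant 2$.
   Context: Graphs are finite and simple. $G^2$ is the graph on $V(G)$ in which distinct $x,y$ are adjacent iff $1\leqslant d_G(x,y)\leqslant 2$. The distinguishing index $D'(H)$ is the least $d$ such that some edge labeling $E(H)\to\{1,\dots,d\}$ is preserved by no non-trivial automorphism of $H$. -}

module Defs where

open import Data.Nat using (ℕ; _+_; _*_; _≤_; _<_)
open import Data.Bool using (Bool; true; false; _∨_; _∧_; if_then_else_)
open import Data.Fin using (Fin; toℕ)
open import Data.Fin.Properties using (_≟_)
open import Data.List using (List; map; filter)
open import Data.Nat.ListAction using (sum)
open import Data.List using (allFin) renaming (length to len)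
open import Data.Product using (Σ; ∃; _×_; _,_)
open import Relation.Nullary using (¬_)
open import Relation.Nullary.Decidable using (⌊_⌋)
open import Relation.Binary.PropositionalEquality using (_≡_)
open import Function.Bundles using (_↔_; Inverse)
import Data.Nat as ℕ

record Graph (n : ℕ) : Set where
  field
    adj    : Fin n → Fin n → Bool
    sym    : ∀ x y → adj x y ≡ adj y x
    irrefl : ∀ x → adj x x ≡ false
open Graph public

Adj : ∀ {n} → Graph n → Fin n → Fin n → Set
Adj G x y = adj G x y ≡ true

data Walk {n : ℕ} (G : Graph n) : Fin n → Fin n → Set where
  here : ∀ {x} → Walk G x x
  step : ∀ {x y z} → Adj G x y → Walk G y z → Walk G x z

Connected : ∀ {n} → Graph n → Set
Connected {n} G = ∀ (x y : Fin n) → Walk G x y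

anyFin : ∀ {n} → (Fin n → Bool) → Bool
anyFin {n} p = Data.List.foldr _∨_ false (map p (allFin n))

-- The square G²: distinct x, y adjacent iff d_G(x,y) ∈ {1,2},
-- i.e. adjacent in G or having a common neighbour in G.
sqAdj : ∀ {n} → Graph n → Fin n → Fin n → Bool
sqAdj G x y =
  if ⌊ x ≟ y ⌋ then false
  else (adj G x y ∨ anyFin (λ z → adj G x z ∧ adj G z y))

countTrue : List Bool → ℕ
countTrue bs = len (filter (λ b → b Data.Bool.≟ true) bs)

numEdges : ∀ {n} → Graph n → ℕ
numEdges {n} G =
  sum (map (λ x → countTrue (map (λ y → ⌊ toℕ x ℕ.<? toℕ y ⌋ ∧ adj G x y) (allFin n)))
           (allFin n))

IsComplete : ∀ {n} → (Fin n → Fin n → Bool) → Set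
IsComplete {n} A = ∀ (x y : Fin n) → ¬ (x ≡ y) → A x y ≡ true

IsAutomorphism : ∀ {n} → (Fin n → Fin n → Bool) → (Fin n ↔ Fin n) → Set
IsAutomorphism {n} A σ = ∀ (x y : Fin n) → A (Inverse.to σ x) (Inverse.to σ y) ≡ A x y

NonTrivial : ∀ {n} → (Fin n ↔ Fin n) → Set
NonTrivial {n} σ = ∃ λ (x : Fin n) → ¬ (Inverse.to σ x ≡ x)

-- An edge labelling with labels in Fin d: a symmetric function on vertex pairs,
-- whose values on edges {x,y} (A x y ≡ true) are the labels.
record EdgeLabelling {n : ℕ} (A : Fin n → Fin n → Bool) (d : ℕ) : Set where
  field
    label  : Fin n → Fin n → Fin d
    lsym   : ∀ x y → label x y ≡ label y x
open EdgeLabelling public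

Preserves : ∀ {n d} {A : Fin n → Fin n → Bool} →
            EdgeLabelling A d → (Fin n ↔ Fin n) → Set
Preserves {n} {A = A} ℓ σ =
  ∀ (x y : Fin n) → A x y ≡ true →
    label ℓ (Inverse.to σ x) (Inverse.to σ y) ≡ label ℓ x y

Distinguishing : ∀ {n d} {A : Fin n → Fin n → Bool} → EdgeLabelling A d → Set
Distinguishing {n} {A = A} ℓ =
  ∀ (σ : Fin n ↔ Fin n) → IsAutomorphism A σ → NonTrivial σ → ¬ Preserves ℓ σ

-- D'(H) ≤ d  iff  some labelling E(H) → {1,…,d} is distinguishing.
DistIndexAtMost : ∀ {n} → (Fin n → Fin n → Bool) → ℕ → Set
DistIndexAtMost A d = Σ (EdgeLabelling A d) Distinguishing

-- Let codeg v be the number of non-neighbours of v in G.  The edge bound says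
-- ∑ codeg ≤ 4n − 10.  If X is a set of at most four vertices such that every
-- vertex is non-adjacent to two members of X, double counting gives
-- ∑ codeg ≥ 2n + 2(n − |X|) ≥ 4n − 8, which is impossible.  Two disjoint
-- non-edges of G², or three pairwise non-adjacent vertices of G², would give
-- such an X; so the non-edges of G² pairwise meet and form no triangle, hence
-- all pass through one vertex c.  Label the edges of G² by a fixed asymmetric
-- graph on the n − 1 ≥ 6 vertices other than c.  A label-preserving
-- automorphism must fix c, the only vertex without an edge of that graph, and
-- so induces an automorphism of it, which is trivial.
module Submission where

open import Defs hiding (sym; irrefl)
open import Data.Nat using (ℕ; zero; suc; _+_; _*_; _≤_; z≤n; s≤s; _<?_)
import Data.Nat.Properties as ℕ
open import Data.Nat.Properties using () renaming (_≟_ to _≟ℕ_)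
open import Data.Nat.ListAction using () renaming (sum to sumˡ)
open import Data.Nat.Tactic.RingSolver using (solve-∀)
open import Data.Bool using (Bool; true; false; not; _∧_; _∨_)
import Data.Bool as Bool
open import Data.Bool.Properties using (∨-zeroʳ; ∨-comm; ∧-comm; T-≡; ¬-not)
open import Data.Bool.ListAction using (any)
open import Data.Fin using (Fin; zero; suc; toℕ; inject₁; punchIn; punchOut)
open import Data.Fin.Patterns using (0F; 1F; 2F; 3F; 4F; 5F)
open import Data.Fin.Properties
  using (_≟_; toℕ-injective; toℕ-inject₁; any?; punchInᵢ≢i; punchOut-cong; punchOut-punchIn; punchIn-punchOut)
open import Data.Fin.Permutation
  using (Permutation′; _⟨$⟩ʳ_; _⟨$⟩ˡ_; inverseˡ; inverseʳ; remove; punchIn-permute)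
open import Data.List using (List; []; _∷_; length; tabulate; allFin; map; foldr)
import Data.List.Properties as List
open import Data.List.Membership.Propositional using (_∈_; lose)
open import Data.List.Membership.Propositional.Properties using (∈-allFin)
open import Data.List.Relation.Unary.Any using (here; there)
open import Data.List.Relation.Unary.Any.Properties using (any⁺)
open import Data.Empty using (⊥; ⊥-elim)
open import Data.Product using (∃; _×_; _,_; proj₁; proj₂)
open import Data.Sum using (_⊎_; inj₁; inj₂)
open import Function using (_∘_; id)
open import Function.Bundles using (Equivalence)
open import Relation.Nullary using (¬_; yes; no; does; contradiction)
open import Relation.Nullary.Decidable using (⌊_⌋; dec-true; dec-false; from-no; _×-dec_; ¬?)
open import Relation.Binary.Definitions using (Decidable; Symmetric)
open import Relation.Binary.PropositionalEquality
open import Algebra.Properties.Semiring.Sum ℕ.+-*-semiring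
  using (sum; sum-syntax; ∑-distrib-+; ∑-comm; sum-cong-≗; sum-replicate-zero; *-distribˡ-sum)
open ℕ.≤-Reasoning

∑-const : ∀ n k → ∑[ i < n ] k ≡ n * k
∑-const zero    k = refl
∑-const (suc n) k = cong (k +_) (∑-const n k)

∑-mono-≤ : ∀ {n} {f g : Fin n → ℕ} → (∀ i → f i ≤ g i) → sum f ≤ sum g
∑-mono-≤ {zero}  f≤g = z≤n
∑-mono-≤ {suc n} f≤g = ℕ.+-mono-≤ (f≤g zero) (∑-mono-≤ (f≤g ∘ suc))

𝟙 : Bool → ℕ
𝟙 true  = 1
𝟙 false = 0

count : ∀ {n} → (Fin n → Bool) → ℕ
count {n} p = ∑[ i < n ] 𝟙 (p i)

count-false : ∀ n → count {n} (λ _ → false) ≡ 0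
count-false n = sum-replicate-zero n

-- Stated with `does` rather than ⌊_⌋: only `does` computes through suc i ≟ suc x.
count-≟ : ∀ {n} (x : Fin n) → count (λ i → does (i ≟ x)) ≡ 1
count-≟ {suc n} zero    = cong suc (count-false n)
count-≟ {suc n} (suc x) = count-≟ x

count-≥2 : ∀ {n} {p : Fin n → Bool} {a b} → a ≢ b → p a ≡ true → p b ≡ true → 2 ≤ count p
count-≥2 {n} {p} {a} {b} a≢b pa pb = begin
  2                                                        ≡⟨ cong₂ _+_ (count-≟ a) (count-≟ b) ⟨
  count (λ i → does (i ≟ a)) + count (λ i → does (i ≟ b))
                                                           ≡⟨ ∑-distrib-+ (λ i → 𝟙 (does (i ≟ a))) (λ i → 𝟙 (does (i ≟ b))) ⟨
  ∑[ i < n ] (𝟙 (does (i ≟ a)) + 𝟙 (does (i ≟ b)))         ≤⟨ ∑-mono-≤ at-most-one ⟩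
  count p                                                  ∎
  where
  at-most-one : ∀ i → 𝟙 (does (i ≟ a)) + 𝟙 (does (i ≟ b)) ≤ 𝟙 (p i)
  at-most-one i with i ≟ a | i ≟ b
  ... | yes refl | yes refl = contradiction refl a≢b
  ... | yes refl | no _     = ℕ.≤-reflexive (cong 𝟙 (sym pa))
  ... | no _     | yes refl = ℕ.≤-reflexive (cong 𝟙 (sym pb))
  ... | no _     | no _     = z≤n

𝟙-∨ : ∀ a b → 𝟙 (a ∨ b) ≤ 𝟙 a + 𝟙 b
𝟙-∨ true  b = s≤s z≤n
𝟙-∨ false b = ℕ.≤-refl

𝟙-∧ʳ : ∀ a b → 𝟙 (a ∧ b) ≤ 𝟙 b
𝟙-∧ʳ true  b = ℕ.≤-refl
𝟙-∧ʳ false b = z≤n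

count-∧-split : ∀ {n} b (p : Fin n → Bool) →
                count p ≡ count (λ i → b ∧ p i) + count (λ i → not b ∧ p i)
count-∧-split {n} true  p = sym (trans (cong (count p +_) (count-false n)) (ℕ.+-identityʳ _))
count-∧-split {n} false p = sym (cong (_+ count p) (count-false n))

isOneOf : ∀ {n} → List (Fin n) → Fin n → Bool
isOneOf xs i = any (λ x → does (i ≟ x)) xs

isOneOf-∈ : ∀ {n} {xs : List (Fin n)} {i} → i ∈ xs → isOneOf xs i ≡ true
isOneOf-∈ {xs = _ ∷ xs} {i} (here refl) = cong (_∨ isOneOf xs i) (dec-true (i ≟ i) refl)
isOneOf-∈                  (there i∈xs) = trans (cong (_ ∨_) (isOneOf-∈ i∈xs)) (∨-zeroʳ _)

count-isOneOf : ∀ {n} (xs : List (Fin n)) → count (isOneOf xs) ≤ length xs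
count-isOneOf {n} []       = ℕ.≤-reflexive (count-false n)
count-isOneOf {n} (x ∷ xs) = begin
  count (isOneOf (x ∷ xs))                          ≤⟨ ∑-mono-≤ (λ i → 𝟙-∨ (does (i ≟ x)) _) ⟩
  ∑[ i < n ] (𝟙 (does (i ≟ x)) + 𝟙 (isOneOf xs i)) ≡⟨ ∑-distrib-+ (λ i → 𝟙 (does (i ≟ x))) (𝟙 ∘ isOneOf xs) ⟩
  count (λ i → does (i ≟ x)) + count (isOneOf xs)   ≤⟨ ℕ.+-mono-≤ (ℕ.≤-reflexive (count-≟ x)) (count-isOneOf xs) ⟩
  1 + length xs                                     ∎

sumˡ-map-allFin : ∀ {n} (f : Fin n → ℕ) → sumˡ (map f (allFin n)) ≡ sum f
sumˡ-map-allFin f = trans (cong sumˡ (List.map-tabulate id f)) (sumˡ-tabulate f)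
  where
  sumˡ-tabulate : ∀ {n} (f : Fin n → ℕ) → sumˡ (tabulate f) ≡ sum f
  sumˡ-tabulate {zero}  f = refl
  sumˡ-tabulate {suc n} f = cong (f zero +_) (sumˡ-tabulate (f ∘ suc))

countTrue-map-allFin : ∀ {n} (p : Fin n → Bool) → countTrue (map p (allFin n)) ≡ count p
countTrue-map-allFin p = trans (cong countTrue (List.map-tabulate id p)) (countTrue-tabulate p)
  where
  countTrue-∷ : ∀ b bs → countTrue (b ∷ bs) ≡ 𝟙 b + countTrue bs
  countTrue-∷ true  bs = refl
  countTrue-∷ false bs = refl
  countTrue-tabulate : ∀ {n} (p : Fin n → Bool) → countTrue (tabulate p) ≡ count p
  countTrue-tabulate {zero}  p = refl
  countTrue-tabulate {suc n} p =
    trans (countTrue-∷ (p zero) _) (cong (𝟙 (p zero) +_) (countTrue-tabulate (p ∘ suc)))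

anyFin-witness : ∀ {n} (p : Fin n → Bool) z → p z ≡ true → anyFin p ≡ true
anyFin-witness p z pz =
  Equivalence.to T-≡ (any⁺ p (lose (∈-allFin z) (Equivalence.from T-≡ pz)))

anyFin-cong : ∀ {n} {p q : Fin n → Bool} → (∀ z → p z ≡ q z) → anyFin p ≡ anyFin q
anyFin-cong {n} p≗q = cong (foldr _∨_ false) (List.map-cong p≗q (allFin n))

module _ {n} (G : Graph n) where

  nonAdj : Fin n → Fin n → Bool
  nonAdj w i = not (does (i ≟ w) ∨ adj G w i)

  deg codeg : Fin n → ℕ
  deg   w = count (adj G w)
  codeg w = count (nonAdj w)

  nonAdj-sym : ∀ w i → nonAdj w i ≡ nonAdj i w
  nonAdj-sym w i with i ≟ w | w ≟ i
  ... | yes refl | yes _   = refl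
  ... | yes i≡w  | no w≢i  = contradiction (sym i≡w) w≢i
  ... | no i≢w   | yes w≡i = contradiction (sym w≡i) i≢w
  ... | no _     | no _    = cong not (Graph.sym G w i)

  nonAdj-false : ∀ {w i} → nonAdj w i ≡ false → i ≡ w ⊎ Adj G w i
  nonAdj-false {w} {i} e with i ≟ w | adj G w i
  ... | yes i≡w | _     = inj₁ i≡w
  ... | no _    | true  = inj₂ refl
  ... | no _    | false = contradiction e λ ()

  adj+nonAdj+≟ : ∀ w i → 𝟙 (adj G w i) + 𝟙 (nonAdj w i) + 𝟙 (does (i ≟ w)) ≡ 1
  adj+nonAdj+≟ w i with i ≟ w
  ... | yes refl rewrite Graph.irrefl G i = refl
  ... | no _ with adj G w i
  ...   | true  = refl
  ...   | false = refl

  deg+codeg : ∀ w → deg w + codeg w + 1 ≡ n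
  deg+codeg w = begin-equality
    deg w + codeg w + 1                                  ≡⟨ cong (deg w + codeg w +_) (count-≟ w) ⟨
    deg w + codeg w + count (λ i → does (i ≟ w))         ≡⟨ cong (_+ count (λ i → does (i ≟ w)))
                                                              (∑-distrib-+ (𝟙 ∘ adj G w) (𝟙 ∘ nonAdj w)) ⟨
    ∑[ i < n ] (𝟙 (adj G w i) + 𝟙 (nonAdj w i)) + count (λ i → does (i ≟ w))
                                                         ≡⟨ ∑-distrib-+ (λ i → 𝟙 (adj G w i) + 𝟙 (nonAdj w i)) _ ⟨
    ∑[ i < n ] (𝟙 (adj G w i) + 𝟙 (nonAdj w i) + 𝟙 (does (i ≟ w)))
                                                         ≡⟨ sum-cong-≗ (adj+nonAdj+≟ w) ⟩
    ∑[ i < n ] 1                                         ≡⟨ ∑-const n 1 ⟩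
    n * 1                                                ≡⟨ ℕ.*-identityʳ n ⟩
    n                                                    ∎

  handshake : 2 * numEdges G ≡ ∑[ w < n ] deg w
  handshake = begin-equality
    2 * numEdges G    ≡⟨ cong (2 *_) numEdges-∑ ⟩
    2 * E             ≡⟨ cong (E +_) (ℕ.+-identityʳ E) ⟩
    E + E             ≡⟨ cong (E +_) (∑-comm forward) ⟩
    E + ∑[ x < n ] ∑[ y < n ] forward y x
                      ≡⟨ ∑-distrib-+ (λ x → ∑[ y < n ] forward x y) (λ x → ∑[ y < n ] forward y x) ⟨
    ∑[ x < n ] (∑[ y < n ] forward x y + ∑[ y < n ] forward y x)
                      ≡⟨ sum-cong-≗ (λ x → ∑-distrib-+ (forward x) (λ y → forward y x)) ⟨
    ∑[ x < n ] ∑[ y < n ] (forward x y + forward y x)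
                      ≡⟨ sum-cong-≗ (λ x → sum-cong-≗ (adj-split x)) ⟨
    ∑[ x < n ] deg x  ∎
    where
    ascending : Fin n → Fin n → Bool
    ascending x y = ⌊ toℕ x <? toℕ y ⌋ ∧ adj G x y
    forward : Fin n → Fin n → ℕ
    forward x y = 𝟙 (ascending x y)
    E : ℕ
    E = ∑[ x < n ] ∑[ y < n ] forward x y
    numEdges-∑ : numEdges G ≡ E
    numEdges-∑ = trans (sumˡ-map-allFin (λ x → countTrue (map (ascending x) (allFin n))))
                       (sum-cong-≗ (λ x → countTrue-map-allFin (ascending x)))
    adj-split : ∀ x y → 𝟙 (adj G x y) ≡ forward x y + forward y x
    adj-split x y with toℕ x <? toℕ y | toℕ y <? toℕ x
    ... | yes x<y | yes y<x = contradiction y<x (ℕ.<-asym x<y)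
    ... | yes _   | no _    = sym (ℕ.+-identityʳ _)
    ... | no _    | yes _   = cong 𝟙 (Graph.sym G x y)
    ... | no x≮y  | no y≮x rewrite toℕ-injective (ℕ.≤-antisym (ℕ.≮⇒≥ y≮x) (ℕ.≮⇒≥ x≮y))
                                 | Graph.irrefl G y = refl

  Far : Fin n → Fin n → Set
  Far x y = x ≢ y × sqAdj G x y ≡ false

  far? : Decidable Far
  far? x y = ¬? (x ≟ y) ×-dec (sqAdj G x y Bool.≟ false)

  incomplete⇒far : ¬ IsComplete (sqAdj G) → ∃ λ x → ∃ λ y → Far x y
  incomplete⇒far incomplete with any? (λ x → any? (λ y → far? x y))
  ... | yes far = far
  ... | no ∄far = ⊥-elim (incomplete λ x y x≢y → ¬-not λ x≁y → ∄far (x , y , x≢y , x≁y))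

  sqAdj-≢ : ∀ {x y} → x ≢ y → sqAdj G x y ≡ (adj G x y ∨ anyFin (λ z → adj G x z ∧ adj G z y))
  sqAdj-≢ {x} {y} x≢y with x ≟ y
  ... | yes x≡y = contradiction x≡y x≢y
  ... | no _    = refl

  far-sym : ∀ {x y} → Far x y → Far y x
  far-sym {x} {y} (x≢y , x≁y) = x≢y ∘ sym ,
    trans (sqAdj-≢ (x≢y ∘ sym))
      (trans (cong₂ _∨_ (Graph.sym G y x) (anyFin-cong common-sym))
        (trans (sym (sqAdj-≢ x≢y)) x≁y))
    where
    common-sym : ∀ z → adj G y z ∧ adj G z x ≡ adj G x z ∧ adj G z y
    common-sym z = trans (cong₂ _∧_ (Graph.sym G y z) (Graph.sym G z x)) (∧-comm (adj G z y) (adj G x z))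

  far⇒¬adj : ∀ {x y} → Far x y → ¬ Adj G x y
  far⇒¬adj {x} {y} (x≢y , x≁y) x~y =
    contradiction (trans (sym x≁y) (trans (sqAdj-≢ x≢y) (cong (_∨ anyFin (λ z → adj G x z ∧ adj G z y)) x~y))) λ ()

  far⇒¬common-nbr : ∀ {x y z} → Far x y → Adj G x z → ¬ Adj G z y
  far⇒¬common-nbr {x} {y} {z} (x≢y , x≁y) x~z z~y
    = contradiction (trans (sym x≁y) (trans (sqAdj-≢ x≢y) (trans (cong (adj G x y ∨_) common) (∨-zeroʳ _)))) λ ()
    where
    common : anyFin (λ z → adj G x z ∧ adj G z y) ≡ true
    common = anyFin-witness (λ z → adj G x z ∧ adj G z y) z (cong₂ _∧_ x~z z~y)

  far-missed : ∀ {x y} → Far x y → ∀ w → nonAdj w x ≡ true ⊎ nonAdj w y ≡ true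
  far-missed {x} {y} far w with nonAdj w x in w≁x | nonAdj w y in w≁y
  ... | true  | _     = inj₁ refl
  ... | false | true  = inj₂ refl
  ... | false | false = ⊥-elim (touches-both (nonAdj-false w≁x) (nonAdj-false w≁y))
    where
    touches-both : x ≡ w ⊎ Adj G w x → y ≡ w ⊎ Adj G w y → ⊥
    touches-both (inj₁ refl) (inj₁ refl) = proj₁ far refl
    touches-both (inj₁ refl) (inj₂ x~y)  = far⇒¬adj far x~y
    touches-both (inj₂ y~x)  (inj₁ refl) = far⇒¬adj far (trans (Graph.sym G x y) y~x)
    touches-both (inj₂ w~x)  (inj₂ w~y)  = far⇒¬common-nbr far (trans (Graph.sym G x w) w~x) w~y

  ∑codeg-lower : (X : Fin n → Bool) → (∀ w → 2 ≤ count (λ i → X i ∧ nonAdj w i)) →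
                 4 * n ≤ ∑[ w < n ] codeg w + 2 * count X
  ∑codeg-lower X missed-twice = begin
    4 * n                                                   ≡⟨ 4n≡2n+2n n ⟩
    n * 2 + n * 2                                           ≡⟨ cong₂ _+_ (∑-const n 2) (∑-const n 2) ⟨
    ∑[ w < n ] 2 + ∑[ w < n ] 2                             ≤⟨ ℕ.+-mono-≤ inside≥ outside≥ ⟩
    ∑[ w < n ] inside w + (∑[ w < n ] outside w + 2 * count X)
                                                            ≡⟨ ℕ.+-assoc (sum inside) (sum outside) _ ⟨
    ∑[ w < n ] inside w + ∑[ w < n ] outside w + 2 * count X
                                                            ≡⟨ cong (_+ 2 * count X) (∑-distrib-+ inside outside) ⟨
    ∑[ w < n ] (inside w + outside w) + 2 * count X         ≡⟨ cong (_+ 2 * count X) codeg≡ ⟩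
    ∑[ w < n ] codeg w + 2 * count X                        ∎
    where
    4n≡2n+2n : ∀ n → 4 * n ≡ n * 2 + n * 2
    4n≡2n+2n = solve-∀
    inside outside : Fin n → ℕ
    inside  w = count (λ i → X w ∧ nonAdj w i)
    outside w = count (λ i → not (X w) ∧ nonAdj w i)
    codeg≡ : ∑[ w < n ] (inside w + outside w) ≡ ∑[ w < n ] codeg w
    codeg≡ = sum-cong-≗ (λ w → sym (count-∧-split (X w) (nonAdj w)))
    inside≥ : ∑[ w < n ] 2 ≤ ∑[ w < n ] inside w
    inside≥ = begin
      ∑[ w < n ] 2                                ≤⟨ ∑-mono-≤ missed-twice ⟩
      ∑[ i < n ] count (λ w → X w ∧ nonAdj i w)   ≡⟨ sum-cong-≗ (λ i → sum-cong-≗ (λ w →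
                                                       cong (𝟙 ∘ (X w ∧_)) (nonAdj-sym w i))) ⟨
      ∑[ i < n ] ∑[ w < n ] 𝟙 (X w ∧ nonAdj w i) ≡⟨ ∑-comm (λ w i → 𝟙 (X w ∧ nonAdj w i)) ⟨
      ∑[ w < n ] inside w                         ∎
    outside-pointwise : ∀ w → 2 ≤ outside w + 2 * 𝟙 (X w)
    outside-pointwise w with X w | missed-twice w
    ... | true  | _         = ℕ.m≤n+m 2 _
    ... | false | two≤X∧w≁ = begin
      2                                       ≤⟨ two≤X∧w≁ ⟩
      count (λ i → X i ∧ nonAdj w i)          ≤⟨ ∑-mono-≤ (λ i → 𝟙-∧ʳ (X i) (nonAdj w i)) ⟩
      count (nonAdj w)                        ≡⟨ ℕ.+-identityʳ _ ⟨
      count (nonAdj w) + 0                    ∎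
    outside≥ : ∑[ w < n ] 2 ≤ ∑[ w < n ] outside w + 2 * count X
    outside≥ = begin
      ∑[ w < n ] 2                                     ≤⟨ ∑-mono-≤ outside-pointwise ⟩
      ∑[ w < n ] (outside w + 2 * 𝟙 (X w))             ≡⟨ ∑-distrib-+ outside (λ w → 2 * 𝟙 (X w)) ⟩
      ∑[ w < n ] outside w + ∑[ w < n ] (2 * 𝟙 (X w)) ≡⟨ cong (sum outside +_) (*-distribˡ-sum 2 (𝟙 ∘ X)) ⟨
      ∑[ w < n ] outside w + 2 * count X               ∎

  ∑codeg-upper : n * n + 10 ≤ 2 * numEdges G + 5 * n → ∑[ w < n ] codeg w + 10 ≤ 4 * n
  ∑codeg-upper dense = ℕ.+-cancelˡ-≤ (∑deg + n) _ _ (begin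
    ∑deg + n + (∑codeg + 10)      ≡⟨ rearrange ∑deg ∑codeg n ⟩
    (∑deg + ∑codeg + n) + 10      ≡⟨ cong (_+ 10) total ⟩
    n * n + 10                    ≤⟨ dense ⟩
    2 * numEdges G + 5 * n        ≡⟨ cong (_+ 5 * n) handshake ⟩
    ∑deg + 5 * n                  ≡⟨ split-5n ∑deg n ⟩
    ∑deg + n + 4 * n              ∎)
    where
    ∑deg ∑codeg : ℕ
    ∑deg   = ∑[ w < n ] deg w
    ∑codeg = ∑[ w < n ] codeg w
    rearrange : ∀ d c n → d + n + (c + 10) ≡ d + c + n + 10
    rearrange = solve-∀
    split-5n : ∀ d n → d + 5 * n ≡ d + n + 4 * n
    split-5n = solve-∀
    total : ∑deg + ∑codeg + n ≡ n * n
    total = begin-equality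
      ∑deg + ∑codeg + n                       ≡⟨ cong (_+ n) (∑-distrib-+ deg codeg) ⟨
      ∑[ w < n ] (deg w + codeg w) + n        ≡⟨ cong (sum (λ w → deg w + codeg w) +_) (ℕ.*-identityʳ n) ⟨
      ∑[ w < n ] (deg w + codeg w) + n * 1    ≡⟨ cong (sum (λ w → deg w + codeg w) +_) (∑-const n 1) ⟨
      ∑[ w < n ] (deg w + codeg w) + ∑[ w < n ] 1
                                              ≡⟨ ∑-distrib-+ (λ w → deg w + codeg w) (λ _ → 1) ⟨
      ∑[ w < n ] (deg w + codeg w + 1)        ≡⟨ sum-cong-≗ deg+codeg ⟩
      ∑[ w < n ] n                            ≡⟨ ∑-const n n ⟩
      n * n                                   ∎

  module _ (dense : n * n + 10 ≤ 2 * numEdges G + 5 * n) where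

    ¬missed-twice : (xs : List (Fin n)) → length xs ≤ 4 →
                    ¬ (∀ w → 2 ≤ count (λ i → isOneOf xs i ∧ nonAdj w i))
    ¬missed-twice xs |xs|≤4 missed-twice = from-no (10 ℕ.≤? 8) 10≤8
      where
      ∑codeg : ℕ
      ∑codeg = ∑[ w < n ] codeg w
      |X|≤4 : count (isOneOf xs) ≤ 4
      |X|≤4 = ℕ.≤-trans (count-isOneOf xs) |xs|≤4
      10≤8 : 10 ≤ 8
      10≤8 = ℕ.+-cancelˡ-≤ ∑codeg 10 8 (begin
        ∑codeg + 10                         ≤⟨ ∑codeg-upper dense ⟩
        4 * n                               ≤⟨ ∑codeg-lower (isOneOf xs) missed-twice ⟩
        ∑codeg + 2 * count (isOneOf xs)     ≤⟨ ℕ.+-monoʳ-≤ ∑codeg (ℕ.*-monoʳ-≤ 2 |X|≤4) ⟩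
        ∑codeg + 8                          ∎)

    missed-by-two : ∀ xs {w a b} → a ≢ b → a ∈ xs → b ∈ xs → nonAdj w a ≡ true → nonAdj w b ≡ true →
                    2 ≤ count (λ i → isOneOf xs i ∧ nonAdj w i)
    missed-by-two _ a≢b a∈xs b∈xs w≁a w≁b =
      count-≥2 a≢b (cong₂ _∧_ (isOneOf-∈ a∈xs) w≁a) (cong₂ _∧_ (isOneOf-∈ b∈xs) w≁b)

    far-pairs-meet : ∀ {x y u v} → Far x y → Far u v → x ≡ u ⊎ x ≡ v ⊎ y ≡ u ⊎ y ≡ v
    far-pairs-meet {x} {y} {u} {v} xy uv with x ≟ u | x ≟ v | y ≟ u | y ≟ v
    ... | yes x≡u | _       | _       | _       = inj₁ x≡u
    ... | no _    | yes x≡v | _       | _       = inj₂ (inj₁ x≡v)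
    ... | no _    | no _    | yes y≡u | _       = inj₂ (inj₂ (inj₁ y≡u))
    ... | no _    | no _    | no _    | yes y≡v = inj₂ (inj₂ (inj₂ y≡v))
    ... | no x≢u  | no x≢v  | no y≢u  | no y≢v  = ⊥-elim (¬missed-twice xyuv ℕ.≤-refl missed-twice)
      where
      xyuv : List (Fin n)
      xyuv = x ∷ y ∷ u ∷ v ∷ []
      x∈ : x ∈ xyuv
      x∈ = here refl
      y∈ : y ∈ xyuv
      y∈ = there (here refl)
      u∈ : u ∈ xyuv
      u∈ = there (there (here refl))
      v∈ : v ∈ xyuv
      v∈ = there (there (there (here refl)))
      missed-twice : ∀ w → 2 ≤ count (λ i → isOneOf xyuv i ∧ nonAdj w i)
      missed-twice w with far-missed xy w | far-missed uv w
      ... | inj₁ w≁x | inj₁ w≁u = missed-by-two xyuv x≢u x∈ u∈ w≁x w≁u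
      ... | inj₁ w≁x | inj₂ w≁v = missed-by-two xyuv x≢v x∈ v∈ w≁x w≁v
      ... | inj₂ w≁y | inj₁ w≁u = missed-by-two xyuv y≢u y∈ u∈ w≁y w≁u
      ... | inj₂ w≁y | inj₂ w≁v = missed-by-two xyuv y≢v y∈ v∈ w≁y w≁v

    ¬far-triangle : ∀ {x y u} → Far x y → Far y u → Far x u → ⊥
    ¬far-triangle {x} {y} {u} xy yu xu = ¬missed-twice xyu (ℕ.n≤1+n 3) missed-twice
      where
      xyu : List (Fin n)
      xyu = x ∷ y ∷ u ∷ []
      x∈ : x ∈ xyu
      x∈ = here refl
      y∈ : y ∈ xyu
      y∈ = there (here refl)
      u∈ : u ∈ xyu
      u∈ = there (there (here refl))
      missed-twice : ∀ w → 2 ≤ count (λ i → isOneOf xyu i ∧ nonAdj w i)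
      missed-twice w with far-missed xy w | far-missed yu w
      ... | inj₁ w≁x | inj₁ w≁y = missed-by-two xyu (proj₁ xy) x∈ y∈ w≁x w≁y
      ... | inj₁ w≁x | inj₂ w≁u = missed-by-two xyu (proj₁ xu) x∈ u∈ w≁x w≁u
      ... | inj₂ w≁y | inj₂ w≁u = missed-by-two xyu (proj₁ yu) y∈ u∈ w≁y w≁u
      ... | inj₂ w≁y | inj₁ _ with far-missed xu w
      ...   | inj₁ w≁x = missed-by-two xyu (proj₁ xy) x∈ y∈ w≁x w≁y
      ...   | inj₂ w≁u = missed-by-two xyu (proj₁ yu) y∈ u∈ w≁y w≁u

module _ {n} {R : Fin n → Fin n → Set} (R? : Decidable R) (R-sym : Symmetric R)
         (R-irrefl : ∀ {x y} → R x y → x ≢ y)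
         (R-meet : ∀ {x y u v} → R x y → R u v → x ≡ u ⊎ x ≡ v ⊎ y ≡ u ⊎ y ≡ v)
         (R-¬triangle : ∀ {x y u} → R x y → R y u → R x u → ⊥) where

  intersecting⇒star : ∀ {x y} → R x y → ∃ λ c → ∀ {a b} → R a b → a ≡ c ⊎ b ≡ c
  intersecting⇒star {x} {y} xy with any? (λ a → any? (λ b → R? a b ×-dec ¬? (a ≟ x) ×-dec ¬? (b ≟ x)))
  ... | no ∄ab = x , through-x
    where
    through-x : ∀ {a b} → R a b → a ≡ x ⊎ b ≡ x
    through-x {a} {b} ab with a ≟ x | b ≟ x
    ... | yes a≡x | _       = inj₁ a≡x
    ... | no _    | yes b≡x = inj₂ b≡x
    ... | no a≢x  | no b≢x  = ⊥-elim (∄ab (a , b , ab , a≢x , b≢x))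
  ... | yes (a , b , ab , a≢x , b≢x) = y , through-y
    where
    partner-of-y : ∃ λ u → R y u × u ≢ x
    partner-of-y with R-meet xy ab
    ... | inj₁ x≡a                 = contradiction (sym x≡a) a≢x
    ... | inj₂ (inj₁ x≡b)          = contradiction (sym x≡b) b≢x
    ... | inj₂ (inj₂ (inj₁ refl))  = b , ab , b≢x
    ... | inj₂ (inj₂ (inj₂ refl))  = a , R-sym ab , a≢x
    ¬third : ∀ {w} → R x w → w ≢ y → ⊥
    ¬third {w} xw w≢y with partner-of-y
    ... | u , yu , u≢x with R-meet yu xw
    ...   | inj₁ y≡x                = R-irrefl xy (sym y≡x)
    ...   | inj₂ (inj₁ y≡w)         = w≢y (sym y≡w)
    ...   | inj₂ (inj₂ (inj₁ u≡x))  = u≢x u≡x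
    ...   | inj₂ (inj₂ (inj₂ refl)) = R-¬triangle xy yu xw
    through-y : ∀ {a b} → R a b → a ≡ y ⊎ b ≡ y
    through-y {a} {b} ab with a ≟ y | b ≟ y
    ... | yes a≡y | _       = inj₁ a≡y
    ... | no _    | yes b≡y = inj₂ b≡y
    ... | no a≢y  | no b≢y with R-meet xy ab
    ...   | inj₁ refl               = ⊥-elim (¬third ab b≢y)
    ...   | inj₂ (inj₁ refl)        = ⊥-elim (¬third (R-sym ab) a≢y)
    ...   | inj₂ (inj₂ (inj₁ y≡a))  = contradiction (sym y≡a) a≢y
    ...   | inj₂ (inj₂ (inj₂ y≡b))  = contradiction (sym y≡b) b≢y

-- On 0, 1, …, m − 1: the vertices 1, 2, …, m − 1 form a path and 0 is joined
-- to every vertex from 2 on.  For m ≥ 6 this graph is asymmetric: 0 is the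
-- only vertex with a single non-neighbour, that non-neighbour is 1, and the
-- path is then fixed vertex by vertex.
atLeast2 : ℕ → Bool
atLeast2 (suc (suc _)) = true
atLeast2 _             = false

rigidAdj : ℕ → ℕ → Bool
rigidAdj zero    b       = atLeast2 b
rigidAdj (suc a) zero    = atLeast2 (suc a)
rigidAdj (suc a) (suc b) = does (b ≟ℕ suc a) ∨ does (a ≟ℕ suc b)

rigidAdj-sym : ∀ a b → rigidAdj a b ≡ rigidAdj b a
rigidAdj-sym zero    zero    = refl
rigidAdj-sym zero    (suc b) = refl
rigidAdj-sym (suc a) zero    = refl
rigidAdj-sym (suc a) (suc b) = ∨-comm (does (b ≟ℕ suc a)) (does (a ≟ℕ suc b))

rigidAdj-irrefl : ∀ a → rigidAdj a a ≡ false
rigidAdj-irrefl zero    = refl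
rigidAdj-irrefl (suc a) rewrite dec-false (a ≟ℕ suc a) (ℕ.1+n≢n ∘ sym) = refl

rigidAdj-path : ∀ a → rigidAdj (suc a) (suc (suc a)) ≡ true
rigidAdj-path a rewrite dec-true (suc a ≟ℕ suc a) refl = refl

rigidAdj-nbrs : ∀ a b → rigidAdj (suc a) b ≡ true → b ≡ 0 ⊎ b ≡ a ⊎ b ≡ suc (suc a)
rigidAdj-nbrs a zero    _   = inj₁ refl
rigidAdj-nbrs a (suc b) a~b with b ≟ℕ suc a | a ≟ℕ suc b
... | yes b≡1+a | _         = inj₂ (inj₂ (cong suc b≡1+a))
... | no _      | yes a≡1+b = inj₂ (inj₁ (sym a≡1+b))
... | no b≢1+a  | no a≢1+b  =
  contradiction (trans (sym a~b) (cong₂ _∨_ (dec-false (b ≟ℕ suc a) b≢1+a) (dec-false (a ≟ℕ suc b) a≢1+b))) λ ()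

rigidGraph : ∀ {m} → Fin m → Fin m → Bool
rigidGraph i j = rigidAdj (toℕ i) (toℕ j)

rigidGraph-sym : ∀ {m} (i j : Fin m) → rigidGraph i j ≡ rigidGraph j i
rigidGraph-sym i j = rigidAdj-sym (toℕ i) (toℕ j)

rigidGraph-irrefl : ∀ {m} (i : Fin m) → rigidGraph i i ≡ false
rigidGraph-irrefl i = rigidAdj-irrefl (toℕ i)

rigidGraph-nbr : ∀ {k} (i : Fin (6 + k)) → ∃ λ j → rigidGraph i j ≡ true
rigidGraph-nbr zero                = 2F , refl
rigidGraph-nbr (suc zero)          = 2F , refl
rigidGraph-nbr (suc (suc _))       = 0F , refl

rigidGraph-nonNbr-0 : ∀ {m} {w : Fin (suc (suc m))} → rigidGraph 0F w ≡ false → w ≡ 0F ⊎ w ≡ 1F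
rigidGraph-nonNbr-0 {w = zero}          _ = inj₁ refl
rigidGraph-nonNbr-0 {w = suc zero}      _ = inj₂ refl
rigidGraph-nonNbr-0 {w = suc (suc _)}   ()

AtMostOneNonNbr : ∀ {m} → Fin m → Set
AtMostOneNonNbr z =
  ∀ {w w′} → w ≢ z → w′ ≢ z → rigidGraph z w ≡ false → rigidGraph z w′ ≡ false → w ≡ w′

atMostOneNonNbr-0 : ∀ {m} → AtMostOneNonNbr {suc (suc m)} 0F
atMostOneNonNbr-0 w≢0 w′≢0 0≁w 0≁w′ with rigidGraph-nonNbr-0 0≁w | rigidGraph-nonNbr-0 0≁w′
... | inj₁ w≡0 | _         = contradiction w≡0 w≢0
... | inj₂ _   | inj₁ w′≡0 = contradiction w′≡0 w′≢0
... | inj₂ refl | inj₂ refl = refl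

atMostOneNonNbr⇒0 : ∀ {k} {z : Fin (6 + k)} → AtMostOneNonNbr z → z ≡ 0F
atMostOneNonNbr⇒0 {z = 0F}                      _   = refl
atMostOneNonNbr⇒0 {z = 1F}                      one = contradiction (one {0F} {3F} (λ ()) (λ ()) refl refl) λ ()
atMostOneNonNbr⇒0 {z = 2F}                      one = contradiction (one {4F} {5F} (λ ()) (λ ()) refl refl) λ ()
atMostOneNonNbr⇒0 {z = 3F}                      one = contradiction (one {1F} {5F} (λ ()) (λ ()) refl refl) λ ()
atMostOneNonNbr⇒0 {z = suc (suc (suc (suc _)))} one = contradiction (one {1F} {2F} (λ ()) (λ ()) refl refl) λ ()

module _ {k} (ρ : Permutation′ (6 + k))
         (ρ-preserves : ∀ i j → rigidGraph (ρ ⟨$⟩ʳ i) (ρ ⟨$⟩ʳ j) ≡ rigidGraph i j) where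

  private
    π : Fin (6 + k) → Fin (6 + k)
    π = ρ ⟨$⟩ʳ_

    π⁻¹ : Fin (6 + k) → Fin (6 + k)
    π⁻¹ = ρ ⟨$⟩ˡ_

  π-injective : ∀ {i j} → π i ≡ π j → i ≡ j
  π-injective {i} {j} πi≡πj = trans (sym (inverseˡ ρ)) (trans (cong π⁻¹ πi≡πj) (inverseˡ ρ))

  atMostOneNonNbr-π : ∀ {z} → AtMostOneNonNbr z → AtMostOneNonNbr (π z)
  atMostOneNonNbr-π {z} one {w} {w′} w≢πz w′≢πz πz≁w πz≁w′ =
    trans (sym (inverseʳ ρ))
      (trans (cong π (one (pull-≢ w≢πz) (pull-≢ w′≢πz) (pull-≁ πz≁w) (pull-≁ πz≁w′))) (inverseʳ ρ))
    where
    pull-≢ : ∀ {v} → v ≢ π z → π⁻¹ v ≢ z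
    pull-≢ v≢πz π⁻¹v≡z = v≢πz (trans (sym (inverseʳ ρ)) (cong π π⁻¹v≡z))
    pull-≁ : ∀ {v} → rigidGraph (π z) v ≡ false → rigidGraph z (π⁻¹ v) ≡ false
    pull-≁ {v} πz≁v = trans (sym (ρ-preserves z (π⁻¹ v))) (trans (cong (rigidGraph (π z)) (inverseʳ ρ)) πz≁v)

  π-fixes-0 : π 0F ≡ 0F
  π-fixes-0 = atMostOneNonNbr⇒0 (atMostOneNonNbr-π atMostOneNonNbr-0)

  π-fixes-1 : π 1F ≡ 1F
  π-fixes-1 with rigidGraph-nonNbr-0 (trans (cong (λ v → rigidGraph v (π 1F)) (sym π-fixes-0)) (ρ-preserves 0F 1F))
  ... | inj₁ π1≡0 = contradiction (π-injective (trans π1≡0 (sym π-fixes-0))) λ ()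
  ... | inj₂ π1≡1 = π1≡1

  π-preserves-nbr-of-fixed : ∀ {p i} → π p ≡ p → rigidGraph p i ≡ true → rigidGraph p (π i) ≡ true
  π-preserves-nbr-of-fixed {p} {i} πp≡p p~i =
    trans (cong (λ v → rigidGraph v (π i)) (sym πp≡p)) (trans (ρ-preserves p i) p~i)

  π-fixes-next : ∀ a i → toℕ i ≡ suc a → (∀ j → toℕ j ≤ a → π j ≡ j) → π i ≡ i
  π-fixes-next a       zero          ()
  π-fixes-next zero    (suc zero)    _      _     = π-fixes-1
  π-fixes-next zero    (suc (suc i)) ()
  π-fixes-next (suc a) (suc i)       i≡2+a  fixed = from-nbrs (rigidAdj-nbrs a (toℕ (π (suc i))) pred~πi)
    where
    toℕ-pred : toℕ (inject₁ i) ≡ suc a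
    toℕ-pred = trans (toℕ-inject₁ i) (ℕ.suc-injective i≡2+a)
    pred~πi : rigidAdj (suc a) (toℕ (π (suc i))) ≡ true
    pred~πi = subst (λ t → rigidAdj t (toℕ (π (suc i))) ≡ true) toℕ-pred
                (π-preserves-nbr-of-fixed (fixed (inject₁ i) (ℕ.≤-reflexive toℕ-pred))
                  (trans (cong₂ rigidAdj toℕ-pred i≡2+a) (rigidAdj-path a)))
    from-nbrs : toℕ (π (suc i)) ≡ 0 ⊎ toℕ (π (suc i)) ≡ a ⊎ toℕ (π (suc i)) ≡ suc (suc a) →
                π (suc i) ≡ suc i
    from-nbrs (inj₁ πi≡0)          = contradiction (π-injective (trans (toℕ-injective πi≡0) (sym π-fixes-0))) λ ()
    from-nbrs (inj₂ (inj₁ πi≡a))   =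
      contradiction (trans (sym πi≡a) (trans (cong toℕ πi≡1+i) i≡2+a)) (ℕ.m≢1+n+m a)
      where
      πi≡1+i : π (suc i) ≡ suc i
      πi≡1+i = π-injective (fixed (π (suc i)) (ℕ.≤-trans (ℕ.≤-reflexive πi≡a) (ℕ.n≤1+n a)))
    from-nbrs (inj₂ (inj₂ πi≡2+a)) = toℕ-injective (trans πi≡2+a (sym i≡2+a))

  π-fixes-below : ∀ a i → toℕ i ≤ a → π i ≡ i
  π-fixes-below zero    zero _ = π-fixes-0
  π-fixes-below (suc a) i i≤1+a with ℕ.m≤n⇒m<n∨m≡n i≤1+a
  ... | inj₁ (s≤s i≤a) = π-fixes-below a i i≤a
  ... | inj₂ i≡1+a     = π-fixes-next a i i≡1+a (π-fixes-below a)

  rigidGraph-rigid : ∀ i → π i ≡ i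
  rigidGraph-rigid i = π-fixes-below (toℕ i) i ℕ.≤-refl

liftAt : ∀ {m} → Fin (suc m) → (Fin m → Fin m → Bool) → Fin (suc m) → Fin (suc m) → Bool
liftAt c Q x y with c ≟ x | c ≟ y
... | no c≢x | no c≢y = Q (punchOut c≢x) (punchOut c≢y)
... | _      | _      = false

module _ {m} {Q : Fin m → Fin m → Bool} (c : Fin (suc m)) where

  liftAt-c-x : ∀ y → liftAt c Q c y ≡ false
  liftAt-c-x y with c ≟ c
  ... | yes _   = refl
  ... | no c≢c  = contradiction refl c≢c

  liftAt-x-c : ∀ x → liftAt c Q x c ≡ false
  liftAt-x-c x with c ≟ x | c ≟ c
  ... | yes _ | _       = refl
  ... | no _  | yes _   = refl
  ... | no _  | no c≢c  = contradiction refl c≢c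

  liftAt-punchIn : ∀ i j → liftAt c Q (punchIn c i) (punchIn c j) ≡ Q i j
  liftAt-punchIn i j with c ≟ punchIn c i | c ≟ punchIn c j
  ... | yes c≡i′ | _        = contradiction (sym c≡i′) (punchInᵢ≢i c i)
  ... | no _     | yes c≡j′ = contradiction (sym c≡j′) (punchInᵢ≢i c j)
  ... | no c≢i′  | no c≢j′  = cong₂ Q (punchOut-punchIn′ c≢i′) (punchOut-punchIn′ c≢j′)
    where
    punchOut-punchIn′ : ∀ {i} (c≢i′ : c ≢ punchIn c i) → punchOut c≢i′ ≡ i
    punchOut-punchIn′ {i} c≢i′ = trans (punchOut-cong c refl) (punchOut-punchIn c)

  liftAt-sym : (∀ i j → Q i j ≡ Q j i) → ∀ x y → liftAt c Q x y ≡ liftAt c Q y x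
  liftAt-sym Q-sym x y with c ≟ x | c ≟ y
  ... | yes _   | yes _   = refl
  ... | yes _   | no _    = refl
  ... | no _    | yes _   = refl
  ... | no c≢x  | no c≢y  = Q-sym (punchOut c≢x) (punchOut c≢y)

  liftAt-irrefl : (∀ i → Q i i ≡ false) → ∀ x → liftAt c Q x x ≡ false
  liftAt-irrefl Q-irrefl x with c ≟ x
  ... | yes _  = refl
  ... | no c≢x = Q-irrefl (punchOut c≢x)

NonEdgesThrough : ∀ {n} → (Fin n → Fin n → Bool) → Fin n → Set
NonEdgesThrough A c = ∀ x y → x ≢ y → A x y ≡ false → x ≡ c ⊎ y ≡ c

bit : Bool → Fin 2
bit false = 0F
bit true  = 1F

bit-injective : ∀ {a b} → bit a ≡ bit b → a ≡ b
bit-injective {false} {false} _ = refl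
bit-injective {true}  {true}  _ = refl

module _ {m} {Q : Fin m → Fin m → Bool}
         (Q-sym : ∀ i j → Q i j ≡ Q j i) (Q-irrefl : ∀ i → Q i i ≡ false)
         (Q-nbr : ∀ i → ∃ λ j → Q i j ≡ true)
         (Q-rigid : ∀ (ρ : Permutation′ m) → (∀ i j → Q (ρ ⟨$⟩ʳ i) (ρ ⟨$⟩ʳ j) ≡ Q i j) →
                    ∀ i → ρ ⟨$⟩ʳ i ≡ i)
         {A : Fin (suc m) → Fin (suc m) → Bool} {c : Fin (suc m)} (through-c : NonEdgesThrough A c) where

  liftedLabelling : EdgeLabelling A 2
  liftedLabelling = record
    { label = λ x y → bit (liftAt c Q x y)
    ; lsym  = λ x y → cong bit (liftAt-sym c Q-sym x y)
    }

  module _ (σ : Permutation′ (suc m)) (σ-aut : IsAutomorphism A σ) (σ-pres : Preserves liftedLabelling σ) where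

    private
      s : Fin (suc m) → Fin (suc m)
      s = σ ⟨$⟩ʳ_

    s-injective : ∀ {x y} → s x ≡ s y → x ≡ y
    s-injective sx≡sy = trans (sym (inverseˡ σ)) (trans (cong (σ ⟨$⟩ˡ_) sx≡sy) (inverseˡ σ))

    liftAt-off-c : ∀ {x y} → x ≡ c ⊎ y ≡ c → liftAt c Q x y ≡ false
    liftAt-off-c (inj₁ refl) = liftAt-c-x c _
    liftAt-off-c (inj₂ refl) = liftAt-x-c c _

    s-preserves-liftAt : ∀ x y → liftAt c Q (s x) (s y) ≡ liftAt c Q x y
    s-preserves-liftAt x y with x ≟ y
    ... | yes refl = trans (liftAt-irrefl c Q-irrefl (s x)) (sym (liftAt-irrefl c Q-irrefl x))
    ... | no x≢y with A x y in x~y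
    ...   | true  = bit-injective (σ-pres x y x~y)
    ...   | false = trans (liftAt-off-c (through-c (s x) (s y) (x≢y ∘ s-injective) (trans (σ-aut x y) x~y)))
                          (sym (liftAt-off-c (through-c x y x≢y x~y)))

    s-fixes-c : s c ≡ c
    s-fixes-c with c ≟ s c
    ... | yes c≡sc = sym c≡sc
    ... | no c≢sc  = contradiction (trans (sym Qij) Qij≡false) λ ()
      where
      i : Fin m
      i = punchOut c≢sc
      j : Fin m
      j = proj₁ (Q-nbr i)
      Qij : Q i j ≡ true
      Qij = proj₂ (Q-nbr i)
      y : Fin (suc m)
      y = σ ⟨$⟩ˡ punchIn c j
      Qij≡false : Q i j ≡ false
      Qij≡false = trans (sym (liftAt-punchIn c i j))
        (trans (cong₂ (liftAt c Q) (punchIn-punchOut c≢sc) (sym (inverseʳ σ)))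
          (trans (s-preserves-liftAt c y) (liftAt-c-x c y)))

    ρ : Permutation′ m
    ρ = remove c σ

    s-punchIn : ∀ i → s (punchIn c i) ≡ punchIn c (ρ ⟨$⟩ʳ i)
    s-punchIn i = trans (punchIn-permute σ c i) (cong (λ d → punchIn d (ρ ⟨$⟩ʳ i)) s-fixes-c)

    ρ-preserves : ∀ i j → Q (ρ ⟨$⟩ʳ i) (ρ ⟨$⟩ʳ j) ≡ Q i j
    ρ-preserves i j = trans (sym (liftAt-punchIn c _ _))
      (trans (cong₂ (liftAt c Q) (sym (s-punchIn i)) (sym (s-punchIn j)))
        (trans (s-preserves-liftAt _ _) (liftAt-punchIn c i j)))

    s-fixes : ∀ x → s x ≡ x
    s-fixes x with c ≟ x
    ... | yes refl = s-fixes-c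
    ... | no c≢x   = trans (cong s (sym (punchIn-punchOut c≢x)))
      (trans (s-punchIn (punchOut c≢x))
        (trans (cong (punchIn c) (Q-rigid ρ ρ-preserves (punchOut c≢x))) (punchIn-punchOut c≢x)))

  liftedLabelling-distinguishing : Distinguishing liftedLabelling
  liftedLabelling-distinguishing σ σ-aut (x , σx≢x) σ-pres = σx≢x (s-fixes σ σ-aut σ-pres x)

nonEdgesThrough⇒distIndex≤2 : ∀ k {A : Fin (7 + k) → Fin (7 + k) → Bool} {c} →
                               NonEdgesThrough A c → DistIndexAtMost A 2
nonEdgesThrough⇒distIndex≤2 k through-c =
  liftedLabelling rigidGraph-sym rigidGraph-irrefl rigidGraph-nbr rigidGraph-rigid through-c ,
  liftedLabelling-distinguishing rigidGraph-sym rigidGraph-irrefl rigidGraph-nbr rigidGraph-rigid through-c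

corollary2p14 : (n : ℕ) (G : Graph n) → 7 ≤ n → Connected G →
    ¬ IsComplete (sqAdj G) →
    n * n + 10 ≤ 2 * numEdges G + 5 * n →
    DistIndexAtMost (sqAdj G) 2
corollary2p14 _ G (s≤s (s≤s (s≤s (s≤s (s≤s (s≤s (s≤s (z≤n {k})))))))) _ incomplete dense =
  nonEdgesThrough⇒distIndex≤2 k (λ x y x≢y x≁y → proj₂ far-star (x≢y , x≁y))
  where
  far-pair : ∃ λ x → ∃ λ y → Far G x y
  far-pair = incomplete⇒far G incomplete
  far-star : ∃ λ c → ∀ {a b} → Far G a b → a ≡ c ⊎ b ≡ c
  far-star = intersecting⇒star (far? G) (far-sym G) proj₁ (far-pairs-meet G dense) (¬far-triangle G dense)
                               (proj₂ (proj₂ far-pair))
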